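{- There exists a deterministic distributed algorithm, taking as input an integer $x$ given identically to all nodes, such that for every feasible graph $G$ of diameter $D$ and election index $\phi$ and every integer $x\ge\phi$, the algorithm run on $G$ with input $x$ correctly performs leader election and works in time at most $D+x+1$.
   Context: A graph is a simple undirected connected graph with $n\ge 3$ anonymous nodes; at each node of degree $d$ the incident edges carry distinct port numbers $0,\dots,d-1$ (local, unrelated at the two endpoints of an edge). The truncated view $\mathcal{V}^l(v)$ is defined inductively: $\mathcal{V}^0(v)$ is a single node; $\mathcal{V}^{l+1}(v)$ is the port-labeled tree rooted at $x_0$ having, for each neighbor $v_i$ of $v$, a child $x_i$ with the ports of edge $\{x_0,x_i\}$ equal to the ports of edge $\{v,v_i\}$ at $v$ and at $v_i$ respectively, and $x_i$ the root of a copy of $\mathcal{V}^l(v_i)$; the view is the infinite limit. The augmented truncated view $\mathcal{B}^l(v)$ is $\mathcal{V}^l(v)$ with leaves labeled by their degrees. A graph is feasible if all node views are distinct. Model: synchronous rounds (LOCAL), all nodes start simultaneously, each round each node exchanges arbitrary messages with all neighbors; initially a node knows only its degree (and here the input $x$); nodes know neither $D$ nor $\phi$. Leader election: each node $v$ outputs $(p_1,q_1,\dots,p_k,q_k)$ such that the path from $v$ whose $i$-th edge has port $p_i$ at the endpoint nearer $v$ and $q_i$ at the other endpoint is a simple path, and all these paths end at a common node. Time = number of rounds until all nodes output. The election index of a feasible graph is the minimum time in which leader election is possible when nodes know the map of the graph (isomorphic copy with ports); equivalently, the smallest $\ell$ such that all $\mathcal{B}^\ell(v)$ are distinct. -}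

module Defs where

open import Level using (Level; suc; zero)
open import Data.Nat using (ℕ; _<_; _≤_; _+_)
open import Data.Fin using (Fin)
open import Data.List using (List; []; _∷_; map; upTo; length)
open import Data.Maybe using (Maybe; just; nothing)
open import Data.Product using (Σ; _×_; _,_; ∃)
open import Data.Unit using (⊤; tt)
open import Relation.Binary.PropositionalEquality using (_≡_; _≢_)
open import Relation.Nullary using (¬_)

-- Ports at v are the naturals 0 .. deg v - 1.  nbr v p is the node at the
-- other end of the edge with port p at v, and port v p is the port number
-- of that edge at the other endpoint.  (Values of nbr/port at p ≥ deg v
-- are irrelevant: nothing below ever uses them.)

record Graph (n : ℕ) : Set where
  field
    deg      : Fin n → ℕ
    nbr      : Fin n → ℕ → Fin n
    port     : Fin n → ℕ → ℕ
    port-ok  : ∀ v p → p < deg v → port v p < deg (nbr v p)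
    nbr-inv  : ∀ v p → p < deg v → nbr (nbr v p) (port v p) ≡ v
    port-inv : ∀ v p → p < deg v → port (nbr v p) (port v p) ≡ p
    no-loop  : ∀ v p → p < deg v → nbr v p ≢ v
    no-multi : ∀ v p q → p < deg v → q < deg v → nbr v p ≡ nbr v q → p ≡ q

open Graph public

module _ {n : ℕ} (G : Graph n) where

  -- PathTo v ps w : the port sequence ps = ((p₁,q₁) ∷ … ∷ (pₖ,qₖ) ∷ [])
  -- describes a walk from v to w whose i-th edge has port pᵢ at the
  -- endpoint nearer v and qᵢ at the other endpoint.
  data PathTo : Fin n → List (ℕ × ℕ) → Fin n → Set where
    here : ∀ {v} → PathTo v [] v
    step : ∀ {v p q ps w} → p < deg G v → port G v p ≡ q →
           PathTo (nbr G v p) ps w → PathTo v ((p , q) ∷ ps) w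

  pathNodes : Fin n → List (ℕ × ℕ) → List (Fin n)
  pathNodes v []             = v ∷ []
  pathNodes v ((p , _) ∷ ps) = v ∷ pathNodes (nbr G v p) ps

  Connected : Set
  Connected = ∀ u v → ∃ λ ps → PathTo u ps v

  IsDiameter : ℕ → Set
  IsDiameter D =
    (∀ u v → ∃ λ ps → length ps ≤ D × PathTo u ps v) ×
    (Σ (Fin n) λ u → Σ (Fin n) λ v → ∀ ps → PathTo u ps v → D ≤ length ps)

data Tree (L : Set) : Set where
  leaf : L → Tree L
  node : List (ℕ × ℕ × Tree L) → Tree L

module _ {n : ℕ} (G : Graph n) where

  V : ℕ → Fin n → Tree ⊤
  V ℕ.zero    v = leaf tt
  V (ℕ.suc l) v = node (map (λ p → p , port G v p , V l (nbr G v p)) (upTo (deg G v)))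

  B : ℕ → Fin n → Tree ℕ
  B ℕ.zero    v = leaf (deg G v)
  B (ℕ.suc l) v = node (map (λ p → p , port G v p , B l (nbr G v p)) (upTo (deg G v)))

  -- feasible: all (infinite) views distinct, i.e. two nodes having equal
  -- truncated views at every depth are equal
  Feasible : Set
  Feasible = ∀ u v → (∀ l → V l u ≡ V l v) → u ≡ v

  BDistinct : ℕ → Set
  BDistinct l = ∀ u v → B l u ≡ B l v → u ≡ v

  IsElectionIndex : ℕ → Set
  IsElectionIndex φ = BDistinct φ × (∀ l → l < φ → ¬ BDistinct l)

record Algorithm : Set₁ where
  field
    State : Set
    Msg   : Set
    init  : ℕ → ℕ → State               -- degree, input x
    send  : State → ℕ → Msg             -- message sent through port p
    trans : State → List Msg → State
    out   : State → Maybe (List (ℕ × ℕ))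

open Algorithm public

module _ (A : Algorithm) {n : ℕ} (G : Graph n) (x : ℕ) where

  run : ℕ → Fin n → State A
  run ℕ.zero    v = init A (deg G v) x
  run (ℕ.suc t) v =
    trans A (run t v)
      (map (λ p → send A (run t (nbr G v p)) (port G v p)) (upTo (deg G v)))

  OutputsAt : Fin n → ℕ → List (ℕ × ℕ) → Set
  OutputsAt v t o = out A (run t v) ≡ just o ×
                    (∀ t' → t' < t → out A (run t' v) ≡ nothing)

module Submission where

-- Every node floods the network, so after t rounds it holds its augmented view B^t(v). Since x ≥ φ,
-- the views B^x(w), encoded as lists of naturals and ordered lexicographically, are distinct codes of
-- the nodes. In round k + 1 + x the view of v shows, for every port path of length ≤ k + 1 from v, the
-- code of its endpoint. At the first k at which every code reached by a path of length k + 1 is already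
-- reached by a shorter path, the ball of radius k around v is closed under neighbours, hence is the
-- whole graph; this happens for some k ≤ D. Node v then knows all codes and outputs a shortest, hence
-- simple, path to the node of least code, which is the same node for every v.

open import Defs hiding (trans)
open import Data.Nat using (ℕ; zero; suc; pred; _+_; _∸_; _≤_; _<_; z≤n; s≤s; s<s⁻¹; z<s)
import Data.Nat.Properties as ℕ
open import Data.Nat.Properties
  using (≤-refl; ≤-reflexive; ≤-trans; ≤-pred; <⇒≤; ≮⇒≥; <-irrefl; <-≤-trans;
         m≤n⇒m≤1+n; m≤n⇒m<n∨m≡n; m<n⇒m<1+n; m<1+n⇒m<n∨m≡n; m≤m+n; m≤n+m;
         +-comm; +-monoˡ-≤; +-cancelʳ-<; +-∸-comm; m+n∸n≡m; m∸n+n≡m; m∸n≢0⇒n<m; 1+n≢0)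
open import Data.Fin using (Fin; fromℕ<)
open import Data.List using (List; []; _∷_; _++_; map; concatMap; length; upTo; applyUpTo; allFin)
open import Data.List.Properties
  using (∷-injective; length-++; length-map; length-upTo; map-∘; map-cong; map-upTo; map-applyUpTo)
open import Data.List.Membership.Propositional using (_∈_; _∉_; find; lose)
open import Data.List.Membership.Propositional.Properties
  using (∈-map⁺; ∈-map⁻; ∈-++⁺ˡ; ∈-++⁺ʳ; ∈-++⁻; ∈-concatMap⁺; ∈-concatMap⁻;
         ∈-upTo⁺; ∈-upTo⁻; ∈-allFin)
open import Data.List.Relation.Unary.Any using (here; there)
import Data.List.Relation.Unary.Any.Properties as Any
open import Data.List.Relation.Unary.All as All using (All)
open import Data.List.Relation.Unary.AllPairs using (_∷_; [])
open import Data.List.Relation.Unary.Unique.Propositional using (Unique)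
open import Data.List.Relation.Binary.Equality.DecPropositional ℕ._≟_ using (_≡?_)
open import Data.List.Membership.DecPropositional _≡?_ using (_∈?_)
open import Data.List.Relation.Binary.Lex.NonStrict using (≤-decTotalOrder)
open import Data.List.Relation.Binary.Pointwise using (Pointwise-≡⇒≡)
open import Data.Maybe using (Maybe; just; nothing; _<∣>_)
open import Data.Product using (Σ; ∃; _×_; _,_; proj₁; proj₂; map₁; map₂)
open import Data.Sum using (_⊎_; inj₁; inj₂; [_,_])
open import Data.Bool using (if_then_else_)
open import Function using (_∘_)
open import Relation.Binary.Bundles using (TotalOrder; DecTotalOrder)
open import Relation.Nullary using (¬_; Dec; yes; no; does; contradiction)
open import Relation.Nullary.Decidable using (dec-true; dec-false)
open import Relation.Unary using (Decidable)
open import Relation.Binary.PropositionalEquality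
  using (_≡_; _≢_; refl; sym; trans; cong; subst; module ≡-Reasoning)

module _ {p} {Q : ℕ → Set p} (Q? : Decidable Q) where

  search-below : ∀ m → (∃ λ k → k < m × Q k × (∀ {j} → j < k → ¬ Q j)) ⊎
                       (∀ {j} → j < m → ¬ Q j)
  search-below zero = inj₂ λ ()
  search-below (suc m) with search-below m
  ... | inj₁ (k , k<m , qk , below) = inj₁ (k , m<n⇒m<1+n k<m , qk , below)
  ... | inj₂ none with Q? m
  ...   | yes qm  = inj₁ (m , ≤-refl , qm , none)
  ...   | no ¬qm = inj₂ λ j<1+m → [ none , (λ { refl → ¬qm }) ] (m<1+n⇒m<n∨m≡n j<1+m)

  least-witness : ∀ {m} → Q m → ∃ λ k → k ≤ m × Q k × (∀ {j} → j < k → ¬ Q j)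
  least-witness {m} qm with search-below m
  ... | inj₁ (k , k<m , qk , below) = k , <⇒≤ k<m , qk , below
  ... | inj₂ none                   = m , ≤-refl , qm , none

Path : Set
Path = List (ℕ × ℕ)

module _ {n : ℕ} (G : Graph n) where

  PathTo-++ : ∀ {u v w ps qs} → PathTo G u ps v → PathTo G v qs w → PathTo G u (ps ++ qs) w
  PathTo-++ here         pt = pt
  PathTo-++ (step p e q) pt = step p e (PathTo-++ q pt)

  Within : ℕ → Fin n → Fin n → Set
  Within k v w = ∃ λ ps → length ps ≤ k × PathTo G v ps w

  Saturated : Fin n → ℕ → Set
  Saturated v k = ∀ {w} → Within (suc k) v w → Within k v w

  within-saturated : ∀ {v k u ps w} → Saturated v k → Within k v u → PathTo G u ps w → Within k v w
  within-saturated sat vu here = vu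
  within-saturated {k = k} sat (qs , qs≤k , pt) (step {p = p} {q} p<d e rest) =
    within-saturated sat (sat (qs ++ (p , q) ∷ [] , len , PathTo-++ pt (step p<d e here))) rest
    where
    len : length (qs ++ (p , q) ∷ []) ≤ suc k
    len = subst (_≤ suc _) (sym (trans (length-++ qs) (+-comm (length qs) 1))) (s≤s qs≤k)

  Shortest : Fin n → Path → Fin n → Set
  Shortest v ps w = ∀ qs → PathTo G v qs w → length ps ≤ length qs

  PathTo-suffix : ∀ {u ps w z} → PathTo G u ps w → z ∈ pathNodes G u ps →
                ∃ λ qs → length qs ≤ length ps × PathTo G z qs w
  PathTo-suffix here         (here refl) = _ , ≤-refl , here
  PathTo-suffix (step p e q) (here refl) = _ , ≤-refl , step p e q
  PathTo-suffix (step p e q) (there z∈) with PathTo-suffix q z∈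
  ... | qs , qs≤ , pt = qs , m≤n⇒m≤1+n qs≤ , pt

  shortest⇒unique : ∀ {v ps w} → PathTo G v ps w → Shortest v ps w → Unique (pathNodes G v ps)
  shortest⇒unique here _ = All.[] ∷ []
  shortest⇒unique {v} (step {p = p} {ps = ps} p<d e rest) shortest =
    All.tabulate revisit ∷ shortest⇒unique rest (λ qs pt → ≤-pred (shortest _ (step p<d e pt)))
    where
    revisit : ∀ {z} → z ∈ pathNodes G (nbr G v p) ps → v ≢ z
    revisit z∈ refl with PathTo-suffix rest z∈
    ... | qs , qs≤ , pt = <-irrefl refl (≤-trans (s≤s qs≤) (shortest qs pt))

-- a port path paired with the code of its endpoint
Entry : Set
Entry = Path × List ℕ

degree : Tree ℕ → ℕ
degree (leaf d)  = d
degree (node cs) = length cs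

truncate : ℕ → Tree ℕ → Tree ℕ
truncate zero    T         = leaf (degree T)
truncate (suc x) (leaf d)  = leaf d
truncate (suc x) (node cs) = node (map (map₂ (map₂ (truncate x))) cs)

paths : ℕ → Tree ℕ → List (Path × Tree ℕ)
pathsVia : ℕ → ℕ × ℕ × Tree ℕ → List (Path × Tree ℕ)
paths zero    T         = ([] , T) ∷ []
paths (suc j) (leaf _)  = []
paths (suc j) (node cs) = concatMap (pathsVia j) cs
pathsVia j (p , q , T) = map (map₁ ((p , q) ∷_)) (paths j T)

-- The accumulator makes the encoding prefix-free, which is what the simultaneous induction below relies on.
encodeWith : Tree ℕ → List ℕ → List ℕ
encodeChildren : List (ℕ × ℕ × Tree ℕ) → List ℕ → List ℕ
encodeWith (leaf d)  rest = 0 ∷ d ∷ rest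
encodeWith (node cs) rest = 1 ∷ length cs ∷ encodeChildren cs rest
encodeChildren []                  rest = rest
encodeChildren ((p , q , T) ∷ cs) rest = p ∷ q ∷ encodeWith T (encodeChildren cs rest)

encode : Tree ℕ → List ℕ
encode T = encodeWith T []

encodeWith-injective : ∀ T T′ {r r′} → encodeWith T r ≡ encodeWith T′ r′ →
                       T ≡ T′ × r ≡ r′
encodeChildren-injective : ∀ cs cs′ {r r′} → length cs ≡ length cs′ →
                           encodeChildren cs r ≡ encodeChildren cs′ r′ → cs ≡ cs′ × r ≡ r′
encodeWith-injective (leaf d)  (leaf d′)  refl = refl , refl
encodeWith-injective (node cs) (node cs′) eq
  with eq-length , eq-children ← ∷-injective (proj₂ (∷-injective eq))
  with refl , refl ← encodeChildren-injective cs cs′ eq-length eq-children = refl , refl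
encodeChildren-injective []                 []                    _         eq = refl , eq
encodeChildren-injective ((p , q , T) ∷ cs) ((p′ , q′ , T′) ∷ cs′) eq-length eq
  with refl , eq₁ ← ∷-injective eq
  with refl , eq₂ ← ∷-injective eq₁
  with refl , eq₃ ← encodeWith-injective T T′ eq₂
  with refl , refl ← encodeChildren-injective cs cs′ (cong pred eq-length) eq₃ = refl , refl

encode-injective : ∀ {T T′} → encode T ≡ encode T′ → T ≡ T′
encode-injective {T} {T′} eq = proj₁ (encodeWith-injective T T′ eq)

label : ℕ → Tree ℕ → List ℕ
label x T = encode (truncate x T)

levels : ℕ → Tree ℕ → ℕ → List Entry
levels x T j = map (map₂ (label x)) (paths j T)

codeOrder : TotalOrder _ _ _
codeOrder = DecTotalOrder.totalOrder (≤-decTotalOrder ℕ.≤-decTotalOrder)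

open TotalOrder codeOrder using () renaming (_≤_ to _≼_)
open import Data.List.Extrema codeOrder using (min; min≈v⁺; argmin; f[argmin]≤f[xs])

least-code : ∀ {n} (code : Fin n → List ℕ) → Fin n → ∃ λ L → ∀ w → code L ≼ code w
least-code code w₀ =
  argmin code w₀ (allFin _) ,
  λ w → All.lookup (f[argmin]≤f[xs] {f = code} w₀ (allFin _)) (∈-allFin w)

pathWith : List ℕ → List Entry → Maybe Path
pathWith c []               = nothing
pathWith c ((ps , c′) ∷ es) = if does (c′ ≡? c) then just ps else pathWith c es

pathWith-just : ∀ {c ps} es → pathWith c es ≡ just ps → (ps , c) ∈ es
pathWith-just {c} ((ps′ , c′) ∷ es) eq with c′ ≡? c
pathWith-just ((ps′ , c′) ∷ es) refl | yes refl = here refl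
... | no _ = there (pathWith-just es eq)

pathWith-nothing : ∀ {c ps} es → pathWith c es ≡ nothing → (ps , c) ∉ es
pathWith-nothing {c} ((ps′ , c′) ∷ es) eq e∈ with c′ ≡? c | e∈
pathWith-nothing ((ps′ , c′) ∷ es) () e∈ | yes _ | _
... | no c′≢c | here refl  = c′≢c refl
... | no _    | there e∈′ = pathWith-nothing es eq e∈′

module Selection (P : ℕ → List Entry) where

  upToLevel : ℕ → List Entry
  upToLevel zero    = P 0
  upToLevel (suc k) = upToLevel k ++ P (suc k)

  ∈-upToLevel⁺ : ∀ {j k e} → j ≤ k → e ∈ P j → e ∈ upToLevel k
  ∈-upToLevel⁺ {k = zero}  z≤n e∈ = e∈
  ∈-upToLevel⁺ {k = suc k} j≤ e∈ with m≤n⇒m<n∨m≡n j≤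
  ... | inj₁ j<   = ∈-++⁺ˡ (∈-upToLevel⁺ (≤-pred j<) e∈)
  ... | inj₂ refl = ∈-++⁺ʳ (upToLevel k) e∈

  ∈-upToLevel⁻ : ∀ k {e} → e ∈ upToLevel k → ∃ λ j → j ≤ k × e ∈ P j
  ∈-upToLevel⁻ zero    e∈ = 0 , z≤n , e∈
  ∈-upToLevel⁻ (suc k) e∈ with ∈-++⁻ (upToLevel k) e∈
  ... | inj₁ e∈′ = let j , j≤k , e∈j = ∈-upToLevel⁻ k e∈′
                   in j , m≤n⇒m≤1+n j≤k , e∈j
  ... | inj₂ e∈′ = suc k , ≤-refl , e∈′

  codesUpTo : ℕ → List (List ℕ)
  codesUpTo k = map proj₂ (upToLevel k)

  Closed : ℕ → Set
  Closed k = All (λ e → proj₂ e ∈ codesUpTo k) (P (suc k))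

  closed? : ∀ k → Dec (Closed k)
  closed? k = All.all? (λ e → proj₂ e ∈? codesUpTo k) (P (suc k))

  earliestPath : List ℕ → ℕ → Maybe Path
  earliestPath c zero    = pathWith c (P 0)
  earliestPath c (suc k) = earliestPath c k <∣> pathWith c (P (suc k))

  earliestPath-nothing : ∀ {c k j ps} → earliestPath c k ≡ nothing → j ≤ k → (ps , c) ∉ P j
  earliestPath-nothing {k = zero}  eq z≤n = pathWith-nothing (P 0) eq
  earliestPath-nothing {c} {suc k} eq j≤ with earliestPath c k in e
  earliestPath-nothing {c} {suc k} () j≤ | just _
  ... | nothing with m≤n⇒m<n∨m≡n j≤
  ...   | inj₁ j<   = earliestPath-nothing e (≤-pred j<)
  ...   | inj₂ refl = pathWith-nothing (P (suc k)) eq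

  earliestPath-just : ∀ {c k ps} → earliestPath c k ≡ just ps →
                      ∃ λ j → j ≤ k × (ps , c) ∈ P j × (∀ {i qs} → i < j → (qs , c) ∉ P i)
  earliestPath-just {k = zero}  eq = 0 , z≤n , pathWith-just (P 0) eq , λ ()
  earliestPath-just {c} {suc k} eq with earliestPath c k in e
  ... | just _ with refl ← eq =
    let j , j≤k , found , none = earliestPath-just e in j , m≤n⇒m≤1+n j≤k , found , none
  ... | nothing =
    suc k , ≤-refl , pathWith-just (P (suc k)) eq , λ i< → earliestPath-nothing e (≤-pred i<)

  -- The default of min takes part in the minimum; callers pass the root's own code, listed at level 0 anyway.
  select : List ℕ → ℕ → Maybe Path
  select own k = if does (closed? k) then earliestPath (min own (codesUpTo k)) k else nothing

  select-open : ∀ {own k} → ¬ Closed k → select own k ≡ nothing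
  select-open {k = k} open′ rewrite dec-false (closed? k) open′ = refl

  select-closed : ∀ {own k} → Closed k → select own k ≡ earliestPath (min own (codesUpTo k)) k
  select-closed {k = k} closed rewrite dec-true (closed? k) closed = refl

record Faithful {n} (G : Graph n) (code : Fin n → List ℕ) (v : Fin n)
                (P : ℕ → List Entry) (h : ℕ) : Set where
  field
    sound    : ∀ {j ps c} → j ≤ h → (ps , c) ∈ P j →
               ∃ λ w → PathTo G v ps w × length ps ≡ j × c ≡ code w
    complete : ∀ {ps w} → length ps ≤ h → PathTo G v ps w → (ps , code w) ∈ P (length ps)

module _ {n} {G : Graph n} {code : Fin n → List ℕ}
         (code-injective : ∀ {u w} → code u ≡ code w → u ≡ w)
         {v P k} (faithful : Faithful G code v P (suc k)) where

  open Selection P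
  open Faithful faithful

  within⇒listed : ∀ {w} → Within G k v w → code w ∈ codesUpTo k
  within⇒listed (ps , ps≤k , pt) =
    ∈-map⁺ proj₂ (∈-upToLevel⁺ ps≤k (complete (m≤n⇒m≤1+n ps≤k) pt))

  listed⇒code : ∀ {c} → c ∈ codesUpTo k → ∃ λ w → Within G k v w × c ≡ code w
  listed⇒code c∈
    with (ps , _) , e∈ , refl ← ∈-map⁻ proj₂ c∈
    with j , j≤k , e∈j ← ∈-upToLevel⁻ k e∈
    with w , pt , len , c≡ ← sound (m≤n⇒m≤1+n j≤k) e∈j
    = w , (ps , subst (_≤ k) (sym len) j≤k , pt) , c≡

  -- A node first reached at level k + 1 has its code listed up to level k, so it was reached there already.
  closed⇒saturated : Closed k → Saturated G v k
  closed⇒saturated closed {w} (ps , ps≤ , pt) with m≤n⇒m<n∨m≡n ps≤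
  ... | inj₁ ps< = ps , ≤-pred ps< , pt
  ... | inj₂ ps≡ =
    let listed = All.lookup closed (subst (λ j → (ps , code w) ∈ P j) ps≡ (complete ps≤ pt))
        w′ , within , c≡ = listed⇒code listed
    in subst (Within G k v) (sym (code-injective c≡)) within

  within⇒closed : (∀ w → Within G k v w) → Closed k
  within⇒closed reach = All.tabulate λ {e} e∈ →
    let w , _ , _ , c≡ = sound ≤-refl e∈
    in subst (_∈ codesUpTo k) (sym c≡) (within⇒listed (reach w))

  min-codesUpTo : ∀ {L} → (∀ w → code L ≼ code w) → (∀ w → Within G k v w) →
                  min (code v) (codesUpTo k) ≡ code L
  min-codesUpTo {L} least reach =
    Pointwise-≡⇒≡ (min≈v⁺ (within⇒listed (reach L)) (All.tabulate bounded) (least v))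
    where
    bounded : ∀ {c} → c ∈ codesUpTo k → code L ≼ c
    bounded c∈ with w , _ , refl ← listed⇒code c∈ = least w

  select-shortest : ∀ {L} → (∀ w → code L ≼ code w) → (∀ w → Within G k v w) →
                    ∃ λ ps → select (code v) k ≡ just ps × PathTo G v ps L × Shortest G v ps L
  select-shortest {L} least reach
    rewrite select-closed {code v} (within⇒closed reach) | min-codesUpTo least reach
    with earliestPath (code L) k in e
  ... | nothing =
    let ps , ps≤k , pt = reach L in
    contradiction (complete (m≤n⇒m≤1+n ps≤k) pt) (earliestPath-nothing e ps≤k)
  ... | just ps =
    let j , j≤k , found , none = earliestPath-just e
        w , pt , len , c≡ = sound (m≤n⇒m≤1+n j≤k) found
        pt′ = subst (PathTo G v ps) (sym (code-injective c≡)) pt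
    in ps , refl , pt′ , λ qs qt → ≮⇒≥ λ qs< →
         none (subst (length qs <_) len qs<)
              (complete (≤-trans (<⇒≤ qs<) (subst (_≤ suc k) (sym len) (m≤n⇒m≤1+n j≤k))) qt)

module _ {n : ℕ} (G : Graph n) where

  degree-B : ∀ m w → degree (B G m w) ≡ deg G w
  degree-B zero    w = refl
  degree-B (suc m) w = trans (length-map _ (upTo (deg G w))) (length-upTo (deg G w))

  truncate-B : ∀ {x m} w → x ≤ m → truncate x (B G m w) ≡ B G x w
  truncate-B {zero}  {m}     w _         = cong leaf (degree-B m w)
  truncate-B {suc x} {suc m} w (s≤s x≤m) = cong node (trans (sym (map-∘ (upTo (deg G w))))
    (map-cong (λ p → cong (λ T → p , port G w p , T) (truncate-B (nbr G w p) x≤m)) (upTo (deg G w))))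

  BDistinct-mono : ∀ {l m} → l ≤ m → BDistinct G l → BDistinct G m
  BDistinct-mono l≤m distinct u w eq =
    distinct u w (trans (sym (truncate-B u l≤m)) (trans (cong (truncate _) eq) (truncate-B w l≤m)))

  children : ℕ → Fin n → List (ℕ × ℕ × Tree ℕ)
  children m v = map (λ p → p , port G v p , B G m (nbr G v p)) (upTo (deg G v))

  paths-B⁻ : ∀ j m {v ps T} → (ps , T) ∈ paths j (B G m v) →
             ∃ λ w → PathTo G v ps w × length ps ≡ j × T ≡ B G (m ∸ j) w
  paths-B⁻ zero    m       (here refl) = _ , here , refl , refl
  paths-B⁻ (suc j) (suc m) {v} e∈
    with p , p∈ , e∈p ← find (Any.map⁻ (∈-concatMap⁻ (pathsVia j) {xs = children m v} e∈))
    with _ , e′∈ , refl ← ∈-map⁻ (map₁ ((p , port G v p) ∷_)) e∈p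
    with w , pt , refl , refl ← paths-B⁻ j m e′∈ = w , step (∈-upTo⁻ p∈) refl pt , refl , refl

  paths-B⁺ : ∀ {m v ps w} → length ps ≤ m → PathTo G v ps w →
             (ps , B G (m ∸ length ps) w) ∈ paths (length ps) (B G m v)
  paths-B⁺ _         here                = here refl
  paths-B⁺ {v = v} {ps = (p , _) ∷ ps} (s≤s ps≤m) (step p<d refl pt) =
    ∈-concatMap⁺ (pathsVia (length ps))
      (Any.map⁺ (lose (∈-upTo⁺ p<d)
                      (∈-map⁺ (map₁ ((p , port G v p) ∷_)) (paths-B⁺ ps≤m pt))))

  viewCode : ℕ → Fin n → List ℕ
  viewCode x w = encode (B G x w)

  levels-faithful : ∀ x h v → Faithful G (viewCode x) v (levels x (B G (h + x) v)) h
  levels-faithful x h v = record { sound = sound ; complete = complete }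
    where
    x≤ : ∀ {j} → j ≤ h → x ≤ (h + x) ∸ j
    x≤ {j} j≤h = subst (x ≤_) (sym (+-∸-comm x j≤h)) (m≤n+m x (h ∸ j))

    sound : ∀ {j ps c} → j ≤ h → (ps , c) ∈ levels x (B G (h + x) v) j →
            ∃ λ w → PathTo G v ps w × length ps ≡ j × c ≡ viewCode x w
    sound {j} j≤h e∈
      with _ , T∈ , refl ← ∈-map⁻ (map₂ (label x)) e∈
      with w , pt , len , refl ← paths-B⁻ j (h + x) T∈
      = w , pt , len , cong encode (truncate-B w (x≤ j≤h))

    complete : ∀ {ps w} → length ps ≤ h → PathTo G v ps w →
               (ps , viewCode x w) ∈ levels x (B G (h + x) v) (length ps)
    complete {ps} {w} ps≤h pt =
      subst (λ c → (ps , c) ∈ levels x (B G (h + x) v) (length ps))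
            (cong encode (truncate-B w (x≤ ps≤h)))
            (∈-map⁺ (map₂ (label x)) (paths-B⁺ (≤-trans ps≤h (m≤m+n h x)) pt))

record Knowledge : Set where
  constructor knowledge
  field
    input : ℕ
    round : ℕ
    view  : Tree ℕ

open Knowledge

enumerate : ∀ {A : Set} → List A → List (ℕ × A)
enumerate []       = []
enumerate (a ∷ as) = (0 , a) ∷ map (map₁ suc) (enumerate as)

enumerate-applyUpTo : ∀ {A : Set} (f : ℕ → A) d →
                      enumerate (applyUpTo f d) ≡ applyUpTo (λ p → p , f p) d
enumerate-applyUpTo f zero    = refl
enumerate-applyUpTo f (suc d) = cong ((0 , f 0) ∷_)
  (trans (cong (map (map₁ suc)) (enumerate-applyUpTo (f ∘ suc) d)) (map-applyUpTo _ (map₁ suc) d))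

decide : ℕ → ℕ → Tree ℕ → Maybe Path
decide x k T = Selection.select (levels x T) (label x T) k

respond : ℕ → ℕ → Tree ℕ → Maybe Path
respond x zero    T = nothing
respond x (suc k) T = decide x k T

-- Messages carry the sender's port and view; they arrive ordered by the receiver's ports, which
-- enumerate supplies.
elect : Algorithm
elect = record
  { State = Knowledge
  ; Msg   = ℕ × Tree ℕ
  ; init  = λ d x → knowledge x 0 (leaf d)
  ; send  = λ s q → q , view s
  ; trans = λ s ms → knowledge (input s) (suc (round s)) (node (enumerate ms))
  ; out   = λ s → respond (input s) (round s ∸ input s) (view s)
  }

run-view : ∀ {n} (G : Graph n) x t v → run elect G x t v ≡ knowledge x t (B G t v)
run-view G x zero    v = refl
run-view G x (suc t) v rewrite run-view G x t v = cong (knowledge x (suc t) ∘ node) (begin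
    enumerate (map (λ p → port G v p , view (run elect G x t (nbr G v p))) (upTo d))
  ≡⟨ cong enumerate (map-cong (λ p → cong (λ s → port G v p , view s) (run-view G x t (nbr G v p)))
                               (upTo d)) ⟩
    enumerate (map neighbour (upTo d))
  ≡⟨ cong enumerate (map-upTo neighbour d) ⟩
    enumerate (applyUpTo neighbour d)
  ≡⟨ enumerate-applyUpTo neighbour d ⟩
    applyUpTo (λ p → p , neighbour p) d
  ≡⟨ sym (map-upTo _ d) ⟩
    map (λ p → p , neighbour p) (upTo d)
  ∎)
  where
  open ≡-Reasoning
  d = deg G v
  neighbour : ℕ → ℕ × Tree ℕ
  neighbour p = port G v p , B G t (nbr G v p)

m∸n≡1+o⇒m≡1+o+n : ∀ {t x k} → t ∸ x ≡ suc k → t ≡ suc k + x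
m∸n≡1+o⇒m≡1+o+n {t} {x} eq =
  trans (sym (m∸n+n≡m (<⇒≤ (m∸n≢0⇒n<m {t} {x} λ eq₀ → 1+n≢0 (trans (sym eq) eq₀)))))
        (cong (_+ x) eq)

module Election {n} (G : Graph n) (x : ℕ) (distinct : BDistinct G x)
                {D : ℕ} (diameter : ∀ u w → Within G D u w) where

  open Selection using (Closed; closed?; select; select-open)

  code : Fin n → List ℕ
  code = viewCode G x

  code-injective : ∀ {u w} → code u ≡ code w → u ≡ w
  code-injective eq = distinct _ _ (encode-injective eq)

  level : Fin n → ℕ → ℕ → List Entry
  level v k = levels x (B G (suc k + x) v)

  decide-B : ∀ v k → decide x k (B G (suc k + x) v) ≡ select (level v k) (code v) k
  decide-B v k = cong (λ c → select (level v k) c k) (cong encode (truncate-B G v (m≤n+m x (suc k))))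

  output-after : ∀ v k → out elect (run elect G x (suc k + x) v) ≡ select (level v k) (code v) k
  output-after v k = begin
      out elect (run elect G x (suc k + x) v)
    ≡⟨ cong (out elect) (run-view G x (suc k + x) v) ⟩
      respond x (suc k + x ∸ x) (B G (suc k + x) v)
    ≡⟨ cong (λ r → respond x r (B G (suc k + x) v)) (m+n∸n≡m (suc k) x) ⟩
      decide x k (B G (suc k + x) v)
    ≡⟨ decide-B v k ⟩
      select (level v k) (code v) k
    ∎
    where open ≡-Reasoning

  quiet-before : ∀ {v k₀} → (∀ {k} → k < k₀ → ¬ Closed (level v k) k) →
                 ∀ t → t < suc k₀ + x → out elect (run elect G x t v) ≡ nothing
  quiet-before {v} {k₀} open-below t t< rewrite run-view G x t v with t ∸ x in eq
  ... | zero  = refl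
  ... | suc k = subst (λ t → decide x k (B G t v) ≡ nothing) (sym t≡)
                  (trans (decide-B v k) (select-open (level v k) {code v} {k} (open-below k<k₀)))
    where
    t≡ : t ≡ suc k + x
    t≡ = m∸n≡1+o⇒m≡1+o+n eq
    k<k₀ : k < k₀
    k<k₀ = s<s⁻¹ (+-cancelʳ-< x (suc k) (suc k₀) (subst (_< suc k₀ + x) t≡ t<))

  faithful : ∀ v k → Faithful G code v (level v k) (suc k)
  faithful v k = levels-faithful G x (suc k) v

  closed-at-diameter : ∀ v → Closed (level v D) D
  closed-at-diameter v = within⇒closed code-injective (faithful v D) (diameter v)

  closed⇒within : ∀ {v k} → Closed (level v k) k → ∀ w → Within G k v w
  closed⇒within {v} {k} closed w =
    within-saturated G (closed⇒saturated code-injective (faithful v k) closed)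
                       ([] , z≤n , here) (proj₂ (proj₂ (diameter v w)))

  elects : ∀ {L} → (∀ w → code L ≼ code w) → ∀ v →
           Σ ℕ λ t → t ≤ D + x + 1 × Σ Path λ o →
             OutputsAt elect G x v t o × PathTo G v o L × Unique (pathNodes G v o)
  elects least v
    with k₀ , k₀≤D , closed , open-below ←
           least-witness (λ k → closed? (level v k) k) (closed-at-diameter v)
    with o , selected , path , shortest ←
           select-shortest code-injective (faithful v k₀) least (closed⇒within closed)
    = suc k₀ + x , ≤-trans (+-monoˡ-≤ x (s≤s k₀≤D)) (≤-reflexive (+-comm 1 (D + x))) , o ,
      (trans (output-after v k₀) selected , quiet-before open-below) ,
      path , shortest⇒unique G path shortest

lemma1 : Σ Algorithm λ A →
           ∀ {n : ℕ} (G : Graph n) → 3 ≤ n → Connected G → Feasible G →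
           ∀ (D φ : ℕ) → IsDiameter G D → IsElectionIndex G φ →
           ∀ (x : ℕ) → φ ≤ x →
           Σ (Fin n) λ leader →
             ∀ (v : Fin n) → Σ ℕ λ t → t ≤ D + x + 1 ×
               Σ (List (ℕ × ℕ)) λ o →
                 OutputsAt A G x v t o × PathTo G v o leader × Unique (pathNodes G v o)
-- Connectivity follows from the diameter bound; of the election index only the distinctness of the B^φ views
-- is needed.
lemma1 = elect , λ G 3≤n _ _ D φ (diameter , _) (distinct , _) x φ≤x →
  let open Election G x (BDistinct-mono G φ≤x distinct) diameter
      L , least = least-code code (fromℕ< (<-≤-trans z<s 3≤n))
  in L , elects least
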